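{- For every positive integer $k$, every connected bipartite permutation graph that does not contain $P_k$ as an induced subgraph is a $k$-letter graph.
   Context: All graphs are finite, simple and undirected. $P_k$ denotes the chordless path on $k$ vertices. A permutation graph is a graph isomorphic to the graph of some permutation $\pi$ of $\{1,\dots,n\}$, with vertex set $\{1,\dots,n\}$ where $i,j$ are adjacent iff $(i-j)(\pi(i)-\pi(j))<0$; a bipartite permutation graph is a graph that is both bipartite and a permutation graph. A graph $G$ is a $k$-letter graph if there exist an alphabet $\Sigma$ with $|\Sigma|\le k$, a set $P\subseteq\Sigma\times\Sigma$ of ordered pairs of letters, and a word $w=w_1w_2\cdots w_n$ over $\Sigma$ such that $G$ is isomorphic to the graph with vertex set $\{1,\dots,n\}$ in which, for $i<j$, vertices $i$ and $j$ are adjacent iff $(w_i,w_j)\in P$. -}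

module Defs where

open import Data.Nat using (ℕ; zero; suc; _+_; _<_)
open import Data.Fin using (Fin; toℕ)
open import Data.Bool using (Bool; true; false; T; not)
open import Data.Product using (Σ; _×_; _,_; ∃)
open import Data.Sum using (_⊎_)
open import Data.List using (List; []; _∷_)
open import Data.Empty using (⊥)
open import Relation.Nullary using (¬_)
open import Relation.Binary.PropositionalEquality using (_≡_)
open import Function.Bundles using (_↔_; _⇔_; Inverse)
open import Function.Definitions using (Injective)

record Graph (n : ℕ) : Set where
  field
    adj   : Fin n → Fin n → Bool
    sym   : ∀ u v → adj u v ≡ adj v u
    irrefl : ∀ u → adj u u ≡ false
open Graph public

Iso : ∀ {n m} → Graph n → Graph m → Set
Iso {n} {m} G H =
  Σ (Fin n ↔ Fin m) λ f →
    ∀ u v → adj G u v ≡ adj H (Inverse.to f u) (Inverse.to f v)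

-- Graph of a permutation π of Fin n: i ~ j iff (i - j)(π i - π j) < 0,
-- i.e. i < j and π j < π i, or j < i and π i < π j.
data Inversion {n : ℕ} (π : Fin n → Fin n) (i j : Fin n) : Set where
  lt : toℕ i < toℕ j → toℕ (π j) < toℕ (π i) → Inversion π i j
  gt : toℕ j < toℕ i → toℕ (π i) < toℕ (π j) → Inversion π i j

IsGraphOfPerm : ∀ {n} → (Fin n ↔ Fin n) → Graph n → Set
IsGraphOfPerm {n} π G = ∀ i j → (T (adj G i j) ⇔ Inversion (Inverse.to π) i j)

IsPermutationGraph : ∀ {n} → Graph n → Set
IsPermutationGraph {n} G =
  Σ (Fin n ↔ Fin n) λ π → Σ (Graph n) λ H → IsGraphOfPerm π H × Iso G H

IsBipartite : ∀ {n} → Graph n → Set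
IsBipartite {n} G = Σ (Fin n → Bool) λ c → ∀ u v → T (adj G u v) → ¬ (c u ≡ c v)

data Walk {n : ℕ} (G : Graph n) : Fin n → Fin n → Set where
  here : ∀ {u} → Walk G u u
  step : ∀ {u w v} → T (adj G u w) → Walk G w v → Walk G u v

-- Connected: any two vertices joined by a walk (the empty graph counts as connected).
IsConnected : ∀ {n} → Graph n → Set
IsConnected {n} G = ∀ u v → Walk G u v

PathAdj : ∀ {k} → Fin k → Fin k → Set
PathAdj i j = (suc (toℕ i) ≡ toℕ j) ⊎ (suc (toℕ j) ≡ toℕ i)

ContainsInducedPath : ∀ {n} → ℕ → Graph n → Set
ContainsInducedPath {n} k G =
  Σ (Fin k → Fin n) λ g → Injective _≡_ _≡_ g ×
    (∀ i j → (T (adj G (g i) (g j)) ⇔ PathAdj i j))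

-- k-letter graph: alphabet Fin k (any alphabet of size ≤ k embeds into Fin k),
-- a relation P on letters, and a word w of length n; for i < j,
-- i ~ j iff (w i , w j) ∈ P.
IsLetterGraphOf : ∀ {n k} → (Fin k → Fin k → Bool) → (Fin n → Fin k) → Graph n → Set
IsLetterGraphOf {n} P w H =
  ∀ i j → toℕ i < toℕ j → adj H i j ≡ P (w i) (w j)

IsKLetterGraph : ∀ {n} → ℕ → Graph n → Set
IsKLetterGraph {n} k G =
  Σ (Fin k → Fin k → Bool) λ P → Σ (Fin n → Fin k) λ w →
    Σ (Graph n) λ H → IsLetterGraphOf P w H × Iso G H

-- Draw G in the plane: vertex v is the point (pos v , val v), and
-- two vertices are adjacent iff one lies north-west of the other.  Run a
-- breadth-first search from the leftmost vertex.  As G is bipartite, adjacent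
-- vertices lie in consecutive layers, so the parent chain of a vertex in
-- layer t is an induced P_(t+1); hence every layer is at most k, and the
-- letter of a vertex is its layer.  The parent of a vertex is its leftmost
-- neighbour in the previous layer, and the key of v lists the positions of
-- its ancestors from the root down to v.  Ordering the vertices by key
-- (lexicographically, larger positions first), the geometry of the plane
-- model shows that for u before v, u and v are adjacent iff v lies one layer
-- below u.  So in this order adjacency is the letter relation {(t , t+1)}.

module Submission where

open import Defs hiding (sym)
open import Data.Nat using (ℕ; zero; suc; _∸_; _<_; _>_; _≤_; s≤s; s≤s⁻¹; pred)
open import Data.Nat.Properties
  using ( _≟_; _≤?_; <-cmp; <-irrefl; <-asym; <-trans; ≤-trans; ≤-refl; ≤-reflexive; ≤-antisym
        ; ≮⇒≥; ≰⇒>; <⇒≤; <⇒≱; ≤∧≢⇒<; 1+n≰n; n≤1+n; m≤n⇒m<n∨m≡n; m≤n+m; suc-injective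
        ; m∸[m∸n]≡n; +-∸-assoc; pred[m∸n]≡m∸[1+n]; <-isStrictTotalOrder )
open import Data.Fin using (Fin; zero; toℕ; fromℕ<; punchOut)
open import Data.Fin.Properties
  using (any?; toℕ-fromℕ<; toℕ-injective; toℕ<n; punchOut-injective; injective⇒≤)
  renaming (_≟_ to _≟ᶠ_)
open import Data.Fin.Subset using (Subset; _∈_; _∉_; ∣_∣)
open import Data.Fin.Subset.Properties using (p⊂q⇒∣p∣<∣q∣; ∈⊤; ⊆⊤; ∣⊤∣≡n)
open import Data.Vec using (tabulate; lookup)
open import Data.Vec.Properties using (lookup⇒[]=; []=⇒lookup; lookup∘tabulate)
open import Data.Bool using (Bool; false; not; T) renaming (_≟_ to _≟ᵇ_)
open import Data.Bool.Properties using (¬-not)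
open import Data.List using (List; []; _∷_; _∷ʳ_; length)
open import Data.List.Properties using (∷ʳ-injectiveʳ)
open import Data.List.Relation.Binary.Lex.Strict using (Lex-<; halt; this; next)
import Data.List.Relation.Binary.Lex.Strict as Lex
open import Data.List.Relation.Binary.Pointwise using (Pointwise; Pointwise-≡⇒≡; ≡⇒Pointwise-≡)
open import Data.Unit using (⊤; tt)
open import Data.Product using (Σ; ∃; ∃-syntax; _×_; _,_; proj₁; proj₂)
open import Data.Sum using (_⊎_; inj₁; inj₂)
open import Data.Empty using (⊥; ⊥-elim)
open import Function using (_∘_)
open import Function.Bundles using (_↔_; _⇔_; Inverse; Equivalence; Injection; mk↔ₛ′; mk⇔)
open import Function.Definitions using (Injective)
open import Function.Properties.Inverse using (↔⇒↣)
open import Relation.Nullary using (¬_; Dec; yes; no; does; _×-dec_; _⊎-dec_; contradiction)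
open import Relation.Nullary.Decidable using (T?; dec-true; does-⇔)
open import Relation.Unary using (Decidable)
open import Relation.Binary using (Rel; Transitive; Trichotomous; Tri; tri<; tri≈; tri>; IsStrictTotalOrder)
import Relation.Binary as B
open import Relation.Binary.Consequences using (tri⇒dec<; tri⇒irr)
import Relation.Binary.Construct.Flip.EqAndOrd as Flip
open import Relation.Binary.PropositionalEquality
  using (_≡_; _≢_; refl; sym; trans; cong; cong₂; subst; subst₂)

record Least (P : ℕ → Set) : Set where
  field
    value   : ℕ
    holds   : P value
    minimal : ∀ {t} → t < value → ¬ P t

  below : ∀ {m} → P m → value ≤ m
  below pm = ≮⇒≥ λ m<value → minimal m<value pm

least : ∀ {P : ℕ → Set} → Decidable P → ∀ m → P m → Least P
least P? m pm with P? 0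
... | yes p0 = record { value = 0 ; holds = p0 ; minimal = λ () }
least P? zero    pm | no ¬p0 = ⊥-elim (¬p0 pm)
least P? (suc m) pm | no ¬p0 = record
  { value   = suc value
  ; holds   = holds
  ; minimal = λ { {zero} _ → ¬p0 ; {suc t} (s≤s t<value) → minimal t<value }
  }
  where open Least (least (P? ∘ suc) m pm)

record Minimiser {n} (P : Fin n → Set) (key : Fin n → ℕ) : Set where
  field
    argmin  : Fin n
    holds   : P argmin
    minimal : ∀ {u} → P u → key argmin ≤ key u

minimiser : ∀ {n} {P : Fin n → Set} → Decidable P → (key : Fin n → ℕ) → ∃ P → Minimiser P key
minimiser {P = P} P? key (u , pu) = fromLeast (least attained? (key u) (u , pu , refl))
  where
  Attained : ℕ → Set
  Attained m = ∃[ v ] P v × key v ≡ m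
  attained? : Decidable Attained
  attained? m = any? (λ v → P? v ×-dec (key v ≟ m))
  fromLeast : Least Attained → Minimiser P key
  fromLeast smallest with Least.holds smallest
  ... | r , pr , key-r = record
    { argmin  = r
    ; holds   = pr
    ; minimal = λ {v} pv → subst (_≤ key v) (sym key-r) (Least.below smallest (v , pv , refl))
    }

minimum : ∀ {m} (f : Fin (suc m) → ℕ) → ∃[ r ] ∀ v → f r ≤ f v
minimum f = Minimiser.argmin least-f , λ v → Minimiser.minimal least-f tt
  where
  least-f : Minimiser (λ _ → ⊤) f
  least-f = minimiser (λ _ → yes tt) f (zero , tt)

injective⇒surjective : ∀ {n} (f : Fin n → Fin n) → Injective _≡_ _≡_ f → ∀ j → ∃[ i ] f i ≡ j
injective⇒surjective {suc n} f f-inj j with any? (λ i → f i ≟ᶠ j)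
... | yes hit = hit
... | no miss = ⊥-elim (<-irrefl refl (injective⇒≤ {f = squeeze} squeeze-inj))
  where
  avoids : ∀ i → j ≢ f i
  avoids i j≡fi = miss (i , sym j≡fi)
  -- If j is missed, removing j from the codomain of f gives an injection
  -- Fin (suc n) → Fin n, which is impossible.
  squeeze : Fin (suc n) → Fin n
  squeeze i = punchOut (avoids i)
  squeeze-inj : Injective _≡_ _≡_ squeeze
  squeeze-inj {x} {y} eq = f-inj (punchOut-injective (avoids x) (avoids y) eq)

injective⇒permutation : ∀ {n} (f : Fin n → Fin n) → Injective _≡_ _≡_ f →
  Σ (Fin n ↔ Fin n) λ σ → ∀ x → Inverse.to σ x ≡ f x
injective⇒permutation {n} f f-inj =
  mk↔ₛ′ f preimage (proj₂ ∘ surj) (λ x → f-inj (proj₂ (surj (f x)))) , λ _ → refl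
  where
  surj : ∀ j → ∃[ i ] f i ≡ j
  surj = injective⇒surjective f f-inj
  preimage : Fin n → Fin n
  preimage = proj₁ ∘ surj

relabel : ∀ {n} → Graph n → (Fin n ↔ Fin n) → Graph n
relabel G σ = record
  { adj    = λ i j → adj G (from i) (from j)
  ; sym    = λ i j → Graph.sym G (from i) (from j)
  ; irrefl = λ i → Graph.irrefl G (from i)
  }
  where open Inverse σ

relabel-iso : ∀ {n} (G : Graph n) (σ : Fin n ↔ Fin n) → Iso G (relabel G σ)
relabel-iso G σ = σ , λ u v → sym (cong₂ (adj G) (strictlyInverseʳ u) (strictlyInverseʳ v))
  where open Inverse σ

∈-select : ∀ {n ℓ} {Q : Fin n → Set ℓ} (Q? : Decidable Q) {u} → u ∈ tabulate (does ∘ Q?) ⇔ Q u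
∈-select {Q = Q} Q? {u} = mk⇔ to from
  where
  lookup-select : lookup (tabulate (does ∘ Q?)) u ≡ does (Q? u)
  lookup-select = lookup∘tabulate (does ∘ Q?) u
  to : u ∈ tabulate (does ∘ Q?) → Q u
  to u∈ with Q? u | trans (sym lookup-select) ([]=⇒lookup u∈)
  ... | yes q | _ = q
  from : Q u → u ∈ tabulate (does ∘ Q?)
  from q = lookup⇒[]= u _ (trans lookup-select (dec-true (Q? u) q))

-- Ranks are below n and strictly monotone, so they
-- define a permutation of Fin n listing the elements in increasing order.
module Ranking {n} {ℓ} {_≺_ : Rel (Fin n) ℓ}
  (≺-trans : Transitive _≺_) (≺-compare : Trichotomous _≡_ _≺_) where

  _≺?_ : B.Decidable _≺_
  _≺?_ = tri⇒dec< ≺-compare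

  predecessors : Fin n → Subset n
  predecessors v = tabulate (does ∘ (_≺? v))

  ∈-predecessors : ∀ {u v} → u ∈ predecessors v ⇔ u ≺ v
  ∈-predecessors {v = v} = ∈-select (_≺? v)

  predecessor⇒≺ : ∀ {u v} → u ∈ predecessors v → u ≺ v
  predecessor⇒≺ = Equivalence.to ∈-predecessors

  ≺⇒predecessor : ∀ {u v} → u ≺ v → u ∈ predecessors v
  ≺⇒predecessor = Equivalence.from ∈-predecessors

  ∉-predecessors : ∀ v → v ∉ predecessors v
  ∉-predecessors v v∈ = tri⇒irr ≺-compare refl (predecessor⇒≺ v∈)

  rank : Fin n → ℕ
  rank v = ∣ predecessors v ∣

  rank-monotone : ∀ {u v} → u ≺ v → rank u < rank v
  rank-monotone {u} {v} u≺v = p⊂q⇒∣p∣<∣q∣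
    ( (λ w∈ → ≺⇒predecessor (≺-trans (predecessor⇒≺ w∈) u≺v))
    , u , ≺⇒predecessor u≺v , ∉-predecessors u )

  rank<n : ∀ v → rank v < n
  rank<n v = subst (rank v <_) (∣⊤∣≡n n)
    (p⊂q⇒∣p∣<∣q∣ (⊆⊤ , v , ∈⊤ , ∉-predecessors v))

  rank-injective : ∀ {u v} → rank u ≡ rank v → u ≡ v
  rank-injective {u} {v} r with ≺-compare u v
  ... | tri< u≺v _ _ = ⊥-elim (<-irrefl r (rank-monotone u≺v))
  ... | tri≈ _ u≡v _ = u≡v
  ... | tri> _ _ v≺u = ⊥-elim (<-irrefl (sym r) (rank-monotone v≺u))

  rank-reflects : ∀ {u v} → rank u < rank v → u ≺ v
  rank-reflects {u} {v} r with ≺-compare u v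
  ... | tri< u≺v _ _ = u≺v
  ... | tri≈ _ refl _ = ⊥-elim (<-irrefl refl r)
  ... | tri> _ _ v≺u = ⊥-elim (<-asym r (rank-monotone v≺u))

  position : Fin n → Fin n
  position v = fromℕ< (rank<n v)

  toℕ-position : ∀ v → toℕ (position v) ≡ rank v
  toℕ-position v = toℕ-fromℕ< (rank<n v)

  ordering : Σ (Fin n ↔ Fin n) λ σ → ∀ v → Inverse.to σ v ≡ position v
  ordering = injective⇒permutation position λ {u} {v} eq →
    rank-injective (trans (sym (toℕ-position u)) (trans (cong toℕ eq) (toℕ-position v)))

-- A graph is a k-letter graph as soon as its vertices carry a strict total
-- order ≺ and a word w over Fin k such that, for u ≺ v, adjacency of u and v
-- is decided by the letters (w u , w v): relabel the vertices by their rank.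
ordered⇒letterGraph : ∀ {n k ℓ} (G : Graph n) {_≺_ : Rel (Fin n) ℓ} →
  Transitive _≺_ → Trichotomous _≡_ _≺_ →
  (P : Fin k → Fin k → Bool) (w : Fin n → Fin k) →
  (∀ u v → u ≺ v → adj G u v ≡ P (w u) (w v)) → IsKLetterGraph k G
ordered⇒letterGraph {n} G ≺-trans ≺-compare P w adj-by-letters =
  P , w ∘ from , relabel G σ , letters , relabel-iso G σ
  where
  open Ranking ≺-trans ≺-compare
  σ : Fin n ↔ Fin n
  σ = proj₁ ordering
  open Inverse σ using (from; strictlyInverseˡ)
  rank-from : ∀ i → rank (from i) ≡ toℕ i
  rank-from i = trans (sym (toℕ-position (from i)))
    (cong toℕ (trans (sym (proj₂ ordering (from i))) (strictlyInverseˡ i)))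
  letters : IsLetterGraphOf P (w ∘ from) (relabel G σ)
  letters i j i<j = adj-by-letters (from i) (from j)
    (rank-reflects (subst₂ _<_ (sym (rank-from i)) (sym (rank-from j)) i<j))

-- Lists of naturals ordered lexicographically with respect to the reversed
-- order on ℕ: at the first difference the larger entry comes first, and a
-- proper prefix comes before its extensions.
infix 4 _⊏_
_⊏_ : List ℕ → List ℕ → Set
_⊏_ = Lex-< _≡_ _>_

⊏-isStrictTotalOrder : IsStrictTotalOrder (Pointwise _≡_) _⊏_
⊏-isStrictTotalOrder = Lex.<-isStrictTotalOrder (Flip.isStrictTotalOrder <-isStrictTotalOrder)

∷ʳ-mono : ∀ {xs ys} a b → length xs ≡ length ys → xs ⊏ ys → xs ∷ʳ a ⊏ ys ∷ʳ b
∷ʳ-mono {_ ∷ _} {_ ∷ _} a b _  (this x>y)     = this x>y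
∷ʳ-mono {_ ∷ _} {_ ∷ _} a b eq (next refl xs⊏ys) = next refl (∷ʳ-mono a b (suc-injective eq) xs⊏ys)

∷ʳ-last : ∀ xs {a b} → b < a → xs ∷ʳ a ⊏ xs ∷ʳ b
∷ʳ-last []       b<a = this b<a
∷ʳ-last (x ∷ xs) b<a = next refl (∷ʳ-last xs b<a)

⊏-∷ʳ : ∀ xs b → xs ⊏ xs ∷ʳ b
⊏-∷ʳ []       b = halt
⊏-∷ʳ (x ∷ xs) b = next refl (⊏-∷ʳ xs b)

⊏-extend : ∀ {xs ys} b → length xs ≡ length ys → xs ⊏ ys → xs ⊏ ys ∷ʳ b
⊏-extend {_ ∷ _} {_ ∷ _} b _  (this x>y)         = this x>y
⊏-extend {_ ∷ _} {_ ∷ _} b eq (next refl xs⊏ys) = next refl (⊏-extend b (suc-injective eq) xs⊏ys)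

⊏-∷ʳ-inv : ∀ {xs ys} b → length xs ≡ length ys → xs ⊏ ys ∷ʳ b → xs ⊏ ys ⊎ xs ≡ ys
⊏-∷ʳ-inv {[]}    {[]}    b _ _ = inj₂ refl
⊏-∷ʳ-inv {_ ∷ _} {_ ∷ _} b _ (this x>y) = inj₁ (this x>y)
⊏-∷ʳ-inv {_ ∷ _} {_ ∷ _} b eq (next refl xs⊏) with ⊏-∷ʳ-inv b (suc-injective eq) xs⊏
... | inj₁ xs⊏ys = inj₁ (next refl xs⊏ys)
... | inj₂ refl   = inj₂ refl

length-∷ʳ : ∀ (xs : List ℕ) x → length (xs ∷ʳ x) ≡ suc (length xs)
length-∷ʳ []       x = refl
length-∷ʳ (_ ∷ xs) x = cong suc (length-∷ʳ xs x)

_∼⟨_⟩_ : ∀ {n} → Fin n → Graph n → Fin n → Set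
u ∼⟨ G ⟩ v = T (adj G u v)

∼-sym : ∀ {n} (G : Graph n) {u v} → u ∼⟨ G ⟩ v → v ∼⟨ G ⟩ u
∼-sym G {u} {v} = subst T (Graph.sym G u v)

∼-irrefl : ∀ {n} (G : Graph n) {u v} → u ∼⟨ G ⟩ v → u ≢ v
∼-irrefl G {u} u∼u refl = subst T (Graph.irrefl G u) u∼u

walkLength : ∀ {n} {G : Graph n} {u v} → Walk G u v → ℕ
walkLength here       = zero
walkLength (step _ w) = suc (walkLength w)

module BreadthFirst {n} (G : Graph n) (root : Fin n) (toRoot : ∀ v → Walk G v root)
                    (key : Fin n → ℕ) where

  infix 4 _∼_
  _∼_ : Fin n → Fin n → Set
  u ∼ v = u ∼⟨ G ⟩ v

  Within : ℕ → Fin n → Set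
  Within zero    v = v ≡ root
  Within (suc t) v = Within t v ⊎ ∃[ u ] v ∼ u × Within t u

  within? : ∀ t → Decidable (Within t)
  within? zero    v = v ≟ᶠ root
  within? (suc t) v = within? t v ⊎-dec any? (λ u → T? (adj G v u) ×-dec within? t u)

  walk-within : ∀ {v} (w : Walk G v root) → Within (walkLength w) v
  walk-within here                     = refl
  walk-within (step {w = u} v∼u walk) = inj₂ (u , v∼u , walk-within walk)

  distance : ∀ v → Least (λ t → Within t v)
  distance v = least (λ t → within? t v) _ (walk-within (toRoot v))

  layer : Fin n → ℕ
  layer v = Least.value (distance v)

  layer-within : ∀ v → Within (layer v) v
  layer-within v = Least.holds (distance v)

  layer-≤ : ∀ {t} v → Within t v → layer v ≤ t
  layer-≤ v = Least.below (distance v)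

  layer≡0 : ∀ v → layer v ≡ 0 → v ≡ root
  layer≡0 v eq = subst (λ t → Within t v) eq (layer-within v)

  layer-edge : ∀ {u v} → u ∼ v → layer u ≤ suc (layer v)
  layer-edge {u} {v} u∼v = layer-≤ u (inj₂ (v , u∼v , layer-within v))

  predecessor : ∀ v {t} → layer v ≡ suc t → ∃[ u ] v ∼ u × layer u ≡ t
  predecessor v {t} eq with subst (λ s → Within s v) eq (layer-within v)
  ... | inj₁ within-t = contradiction within-t (Least.minimal (distance v) (subst (t <_) (sym eq) ≤-refl))
  ... | inj₂ (u , v∼u , within-u) =
    u , v∼u , ≤-antisym (layer-≤ u within-u) (s≤s⁻¹ (subst (_≤ suc (layer u)) eq (layer-edge v∼u)))

  Candidate : Fin n → Fin n → Set
  Candidate v u = v ∼ u × suc (layer u) ≡ layer v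

  parentChoice : ∀ v {t} → layer v ≡ suc t → Minimiser (Candidate v) key
  parentChoice v eq with predecessor v eq
  ... | u , v∼u , layer-u = minimiser candidate? key (u , v∼u , trans (cong suc layer-u) (sym eq))
    where
    candidate? : Decidable (Candidate v)
    candidate? u = T? (adj G v u) ×-dec (suc (layer u) ≟ layer v)

  -- The root is its own parent.
  parentOf : ∀ v m → layer v ≡ m → Fin n
  parentOf v zero    _  = v
  parentOf v (suc t) eq = Minimiser.argmin (parentChoice v eq)

  parent : Fin n → Fin n
  parent v = parentOf v (layer v) refl

  layer-parent : ∀ v → layer (parent v) ≡ pred (layer v)
  layer-parent v = byLayer (layer v) refl
    where
    byLayer : ∀ m (eq : layer v ≡ m) → layer (parentOf v m eq) ≡ pred m
    byLayer zero    eq = eq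
    byLayer (suc t) eq = suc-injective (trans (proj₂ (Minimiser.holds (parentChoice v eq))) eq)

  parent-spec : ∀ v {t} → layer v ≡ suc t →
    Candidate v (parent v) × (∀ {u} → Candidate v u → key (parent v) ≤ key u)
  parent-spec v eq = byLayer (layer v) refl eq
    where
    byLayer : ∀ {t} m (e : layer v ≡ m) → m ≡ suc t →
      Candidate v (parentOf v m e) × (∀ {u} → Candidate v u → key (parentOf v m e) ≤ key u)
    byLayer (suc t) e refl = Minimiser.holds (parentChoice v e) , Minimiser.minimal (parentChoice v e)

  parent-adjacent : ∀ v {t} → layer v ≡ suc t → v ∼ parent v
  parent-adjacent v eq = proj₁ (proj₁ (parent-spec v eq))

  parent-layer : ∀ v {t} → layer v ≡ suc t → layer (parent v) ≡ t
  parent-layer v eq = trans (layer-parent v) (cong pred eq)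

  parent-minimal : ∀ v {u t} → layer v ≡ suc t → v ∼ u → layer u ≡ t → key (parent v) ≤ key u
  parent-minimal v eq v∼u layer-u = proj₂ (parent-spec v eq) (v∼u , trans (cong suc layer-u) (sym eq))

  ancestor : ℕ → Fin n → Fin n
  ancestor zero    v = v
  ancestor (suc m) v = parent (ancestor m v)

  layer-ancestor : ∀ m v → layer (ancestor m v) ≡ layer v ∸ m
  layer-ancestor zero    v = refl
  layer-ancestor (suc m) v = trans (layer-parent (ancestor m v))
    (trans (cong pred (layer-ancestor m v)) (pred[m∸n]≡m∸[1+n] (layer v) m))

  module Separated (separated : ∀ {u v} → u ∼ v → layer u ≢ layer v) where

    consecutive : ∀ {u v} → u ∼ v → suc (layer u) ≡ layer v ⊎ suc (layer v) ≡ layer u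
    consecutive {u} {v} u∼v with <-cmp (layer u) (layer v)
    ... | tri< lu<lv _ _ = inj₁ (≤-antisym lu<lv (layer-edge (∼-sym G u∼v)))
    ... | tri≈ _ lu≡lv _ = ⊥-elim (separated u∼v lu≡lv)
    ... | tri> _ _ lv<lu = inj₂ (≤-antisym lv<lu (layer-edge u∼v))

    ancestors-inducedPath : ∀ {k} x → layer x ≡ k → ContainsInducedPath (suc k) G
    ancestors-inducedPath {k} x layer-x = path , path-injective , λ i j → mk⇔ (to i j) (from i j)
      where
      path : Fin (suc k) → Fin n
      path i = ancestor (k ∸ toℕ i) x
      i≤k : ∀ (i : Fin (suc k)) → toℕ i ≤ k
      i≤k i = s≤s⁻¹ (toℕ<n i)
      layer-path : ∀ i → layer (path i) ≡ toℕ i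
      layer-path i = trans (layer-ancestor (k ∸ toℕ i) x)
        (trans (cong (_∸ (k ∸ toℕ i)) layer-x) (m∸[m∸n]≡n (i≤k i)))
      path-injective : ∀ {i j} → path i ≡ path j → i ≡ j
      path-injective {i} {j} eq = toℕ-injective (trans (sym (layer-path i)) (trans (cong layer eq) (layer-path j)))
      to : ∀ i j → path i ∼ path j → PathAdj i j
      to i j adjacent = subst₂ (λ a b → suc a ≡ b ⊎ suc b ≡ a) (layer-path i) (layer-path j) (consecutive adjacent)
      parentStep : ∀ i j → suc (toℕ i) ≡ toℕ j → path j ∼ path i
      parentStep i j eq = subst (λ m → path j ∼ ancestor m x) (ancestor-index i j eq)
        (parent-adjacent (path j) (trans (layer-path j) (sym eq)))
        where
        ancestor-index : ∀ (i j : Fin (suc k)) → suc (toℕ i) ≡ toℕ j → suc (k ∸ toℕ j) ≡ k ∸ toℕ i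
        ancestor-index i j eq = trans (sym (+-∸-assoc 1 (i≤k j))) (cong (suc k ∸_) (sym eq))
      from : ∀ i j → PathAdj i j → path i ∼ path j
      from i j (inj₁ eq) = ∼-sym G (parentStep i j eq)
      from i j (inj₂ eq) = parentStep j i eq

    layer-bound : ∀ {k} → ¬ ContainsInducedPath (suc k) G → ∀ v → layer v < suc k
    layer-bound {k} noPath v with k ≤? layer v
    ... | no  k≰lv = s≤s (<⇒≤ (≰⇒> k≰lv))
    ... | yes k≤lv = contradiction (ancestors-inducedPath (ancestor (layer v ∸ k) v)
                       (trans (layer-ancestor (layer v ∸ k) v) (m∸[m∸n]≡n k≤lv))) noPath

2+n≰n : ∀ {m s} → m ≡ suc (suc s) → ¬ m ≤ s
2+n≰n {s = s} refl 2+s≤s = 1+n≰n (≤-trans (n≤1+n (suc s)) 2+s≤s)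

-- In the plane model of a permutation graph vertex v is the point (pos v , val v);
-- u lies north-west of v when it is left of v and above it.
NorthWest : ∀ {n} (pos val : Fin n → ℕ) → Fin n → Fin n → Set
NorthWest pos val u v = pos u < pos v × val v < val u

record PlaneModel {n} (G : Graph n) : Set where
  field
    pos val       : Fin n → ℕ
    pos-injective : ∀ {u v} → pos u ≡ pos v → u ≡ v
    val-injective : ∀ {u v} → val u ≡ val v → u ≡ v
    adjacent⇔crossing : ∀ u v → u ∼⟨ G ⟩ v ⇔ (NorthWest pos val u v ⊎ NorthWest pos val v u)

-- Every permutation graph has a plane model: if f is the isomorphism onto the
-- graph of π, take pos = f and val = π ∘ f.
planeModel : ∀ {n} (G : Graph n) → IsPermutationGraph G → PlaneModel G
planeModel G (π , H , H-of-π , f , G≅H) = record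
  { pos               = λ u → toℕ (to f u)
  ; val               = λ u → toℕ (to π (to f u))
  ; pos-injective     = λ eq → injective f (toℕ-injective eq)
  ; val-injective     = λ eq → injective f (injective π (toℕ-injective eq))
  ; adjacent⇔crossing = λ u v → mk⇔
      (λ u∼v → fromInversion (Equivalence.to (H-of-π (to f u) (to f v)) (subst T (G≅H u v) u∼v)))
      (λ crossing → subst T (sym (G≅H u v)) (Equivalence.from (H-of-π (to f u) (to f v)) (toInversion crossing)))
  }
  where
  open Inverse using (to)
  injective : ∀ {m} (g : Fin m ↔ Fin m) → ∀ {x y} → to g x ≡ to g y → x ≡ y
  injective g = Injection.injective (↔⇒↣ g)
  fromInversion : ∀ {i j} → Inversion (to π) i j →
    NorthWest toℕ (toℕ ∘ to π) i j ⊎ NorthWest toℕ (toℕ ∘ to π) j i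
  fromInversion (lt i<j πj<πi) = inj₁ (i<j , πj<πi)
  fromInversion (gt j<i πi<πj) = inj₂ (j<i , πi<πj)
  toInversion : ∀ {i j} →
    NorthWest toℕ (toℕ ∘ to π) i j ⊎ NorthWest toℕ (toℕ ∘ to π) j i → Inversion (to π) i j
  toInversion (inj₁ (i<j , πj<πi)) = lt i<j πj<πi
  toInversion (inj₂ (j<i , πi<πj)) = gt j<i πi<πj

module BipartitePlane {n} (G : Graph n) (M : PlaneModel G)
  (colour : Fin n → Bool) (proper : ∀ {u v} → u ∼⟨ G ⟩ v → colour u ≢ colour v) where

  open PlaneModel M public

  infix 4 _∼_ _↘_
  _∼_ : Fin n → Fin n → Set
  u ∼ v = u ∼⟨ G ⟩ v

  _↘_ : Fin n → Fin n → Set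
  _↘_ = NorthWest pos val

  ↘⇒∼ : ∀ {u v} → u ↘ v → u ∼ v
  ↘⇒∼ {u} {v} u↘v = Equivalence.from (adjacent⇔crossing u v) (inj₁ u↘v)

  rightNeighbour : ∀ {u v} → u ∼ v → pos u < pos v → u ↘ v
  rightNeighbour {u} {v} u∼v pu<pv with Equivalence.to (adjacent⇔crossing u v) u∼v
  ... | inj₁ u↘v       = u↘v
  ... | inj₂ (pv<pu , _) = ⊥-elim (<-asym pu<pv pv<pu)

  bothDiffer : ∀ {u v w} → colour u ≢ colour w → colour v ≢ colour w → colour u ≡ colour v
  bothDiffer u≢w v≢w = trans (¬-not u≢w) (sym (¬-not v≢w))

  sameColour-val : ∀ {u v} → colour u ≡ colour v → pos u < pos v → val u < val v
  sameColour-val {u} {v} same pu<pv with <-cmp (val u) (val v)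
  ... | tri< vu<vv _ _ = vu<vv
  ... | tri≈ _ vu≡vv _ = ⊥-elim (<-irrefl (cong pos (val-injective vu≡vv)) pu<pv)
  ... | tri> _ _ vv<vu = ⊥-elim (proper (↘⇒∼ (pu<pv , vv<vu)) same)

  sameColour-pos : ∀ {u v} → colour u ≡ colour v → val u < val v → pos u < pos v
  sameColour-pos {u} {v} same vu<vv with <-cmp (pos u) (pos v)
  ... | tri< pu<pv _ _ = pu<pv
  ... | tri≈ _ pu≡pv _ = ⊥-elim (<-irrefl (cong val (pos-injective pu≡pv)) vu<vv)
  ... | tri> _ _ pv<pu = ⊥-elim (proper (∼-sym G (↘⇒∼ (pv<pu , vu<vv))) same)

  -- All neighbours of a vertex lie on the same side of it: neighbours y' left
  -- and y right of w would be adjacent although equally coloured.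
  neighbours-right : ∀ {w y y'} → w ∼ y → w ∼ y' → pos w < pos y → pos w < pos y'
  neighbours-right {w} {y} {y'} w∼y w∼y' pw<py with <-cmp (pos w) (pos y')
  ... | tri< pw<py' _ _ = pw<py'
  ... | tri≈ _ pw≡py' _ = ⊥-elim (∼-irrefl G w∼y' (pos-injective pw≡py'))
  ... | tri> _ _ py'<pw = ⊥-elim (proper y'∼y (bothDiffer (proper (∼-sym G w∼y')) (proper (∼-sym G w∼y))))
    where
    y'∼y : y' ∼ y
    y'∼y = ↘⇒∼ ( <-trans py'<pw pw<py
                , <-trans (proj₂ (rightNeighbour w∼y pw<py)) (proj₂ (rightNeighbour (∼-sym G w∼y') py'<pw)))

  neighbours-left : ∀ {w y y'} → w ∼ y → w ∼ y' → pos y < pos w → pos y' < pos w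
  neighbours-left {w} {y} {y'} w∼y w∼y' py<pw with <-cmp (pos y') (pos w)
  ... | tri< py'<pw _ _ = py'<pw
  ... | tri≈ _ py'≡pw _ = ⊥-elim (∼-irrefl G w∼y' (sym (pos-injective py'≡pw)))
  ... | tri> _ _ pw<py' = ⊥-elim (proper y∼y' (bothDiffer (proper (∼-sym G w∼y)) (proper (∼-sym G w∼y'))))
    where
    y∼y' : y ∼ y'
    y∼y' = ↘⇒∼ ( <-trans py<pw pw<py'
                , <-trans (proj₂ (rightNeighbour w∼y' pw<py')) (proj₂ (rightNeighbour (∼-sym G w∼y) py<pw)))

  module Rooted (root : Fin n) (leftmost : ∀ v → pos root ≤ pos v)
                (toRoot : ∀ v → Walk G v root) where

    open BreadthFirst G root toRoot pos public hiding (_∼_)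

    A : Fin n → Set
    A v = colour v ≡ colour root

    A-neighbour : ∀ {u v} → u ∼ v → A u → ¬ A v
    A-neighbour u∼v Au Av = proper u∼v (trans Au (sym Av))

    B-neighbour : ∀ {u v} → u ∼ v → ¬ A u → A v
    B-neighbour u∼v ¬Au = bothDiffer (proper (∼-sym G u∼v)) (λ eq → ¬Au (sym eq))

    nothing-left-of-root : ∀ {v} → ¬ pos v < pos root
    nothing-left-of-root {v} pv<pr = <⇒≱ pv<pr (leftmost v)

    Oriented : Fin n → Set
    Oriented u = ∀ {v} → u ∼ v → (A u → pos u < pos v) × (¬ A u → pos v < pos u)

    -- Orientation propagates along edges, starting from the leftmost root.
    oriented : ∀ {u} → Walk G u root → Oriented u
    oriented here {v} root∼v =
      (λ _ → ≤∧≢⇒< (leftmost v) (λ eq → ∼-irrefl G root∼v (pos-injective eq))) , λ ¬A → ⊥-elim (¬A refl)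
    oriented (step u∼x walk) u∼v =
        (λ Au  → neighbours-right u∼x u∼v (proj₂ (oriented walk (∼-sym G u∼x)) (A-neighbour u∼x Au)))
      , (λ ¬Au → neighbours-left u∼x u∼v (proj₁ (oriented walk (∼-sym G u∼x)) (B-neighbour u∼x ¬Au)))

    A-northWest : ∀ {u v} → A u → u ∼ v → u ↘ v
    A-northWest {u} Au u∼v = rightNeighbour u∼v (proj₁ (oriented (toRoot u) u∼v) Au)

    B-northWest : ∀ {u v} → ¬ A v → u ∼ v → u ↘ v
    B-northWest {v = v} ¬Av u∼v = rightNeighbour u∼v (proj₂ (oriented (toRoot v) (∼-sym G u∼v)) ¬Av)

    alternate : ℕ → Bool → Bool
    alternate zero    b = b
    alternate (suc t) b = not (alternate t b)

    colour-layer : ∀ v → colour v ≡ alternate (layer v) (colour root)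
    colour-layer v = byLayer (layer v) v refl
      where
      byLayer : ∀ m v → layer v ≡ m → colour v ≡ alternate m (colour root)
      byLayer zero    v eq = cong colour (layer≡0 v eq)
      byLayer (suc t) v eq = trans (¬-not (proper (parent-adjacent v eq)))
                                   (cong not (byLayer t (parent v) (parent-layer v eq)))

    sameLayer⇒sameColour : ∀ u v → layer u ≡ layer v → colour u ≡ colour v
    sameLayer⇒sameColour u v eq =
      trans (colour-layer u) (trans (cong (λ t → alternate t (colour root)) eq) (sym (colour-layer v)))

    separated : ∀ {u v} → u ∼ v → layer u ≢ layer v
    separated {u} {v} u∼v eq = proper u∼v (sameLayer⇒sameColour u v eq)

    open Separated separated public

    A? : ∀ v → Dec (A v)
    A? v = colour v ≟ᵇ colour root

    A-parent : ∀ v {t} → layer v ≡ suc t → ¬ A v → A (parent v)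
    A-parent v eq = B-neighbour (parent-adjacent v eq)

    B-parent : ∀ v {t} → layer v ≡ suc t → A v → ¬ A (parent v)
    B-parent v eq = A-neighbour (parent-adjacent v eq)

    layer-monotoneᴬ : ∀ m x x' → layer x' ≡ m → A x → A x' → pos x < pos x' → layer x ≤ m
    layer-monotoneᴬ zero x x' eq Ax Ax' px<px' =
      ⊥-elim (nothing-left-of-root (subst (λ r → pos x < pos r) (layer≡0 x' eq) px<px'))
    layer-monotoneᴬ (suc zero) x x' eq Ax Ax' px<px' =
      ⊥-elim (B-parent x' eq Ax' (cong colour (layer≡0 (parent x') (parent-layer x' eq))))
    layer-monotoneᴬ (suc (suc t)) x x' eq Ax Ax' px<px' = compareVal (<-cmp (val x) (val p'))
      where
      -- x' lies north-west of its parent p', which lies south-east of its own parent q.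
      p' q : Fin n
      p' = parent x'
      q  = parent p'
      ¬Ap' : ¬ A p'
      ¬Ap' = B-parent x' eq Ax'
      p'-layer : layer p' ≡ suc t
      p'-layer = parent-layer x' eq
      Aq : A q
      Aq = A-parent p' p'-layer ¬Ap'
      compareVal : Tri (val x < val p') (val x ≡ val p') (val p' < val x) → layer x ≤ suc (suc t)
      compareVal (tri> _ _ vp'<vx) = subst (λ s → layer x ≤ suc s) p'-layer (layer-edge (↘⇒∼
        (<-trans px<px' (proj₁ (A-northWest Ax' (parent-adjacent x' eq))) , vp'<vx)))
      compareVal (tri≈ _ vx≡vp' _) = ⊥-elim (¬Ap' (subst A (val-injective vx≡vp') Ax))
      compareVal (tri< vx<vp' _ _) = ≤-trans
        (layer-monotoneᴬ t x q (parent-layer p' p'-layer) Ax Aq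
          (sameColour-pos (trans Ax (sym Aq))
            (<-trans vx<vp' (proj₂ (B-northWest ¬Ap' (∼-sym G (parent-adjacent p' p'-layer)))))))
        (m≤n+m t 2)

    layer-monotoneᴮ : ∀ m y y' → layer y' ≡ m → ¬ A y → ¬ A y' → pos y < pos y' → layer y ≤ m
    layer-monotoneᴮ zero y y' eq ¬Ay ¬Ay' py<py' = ⊥-elim (¬Ay' (cong colour (layer≡0 y' eq)))
    layer-monotoneᴮ (suc t) y y' eq ¬Ay ¬Ay' py<py' = comparePos (<-cmp (pos p) (pos y))
      where
      p : Fin n
      p = parent y'
      Ap : A p
      Ap = A-parent y' eq ¬Ay'
      p↘y' : p ↘ y'
      p↘y' = A-northWest Ap (∼-sym G (parent-adjacent y' eq))
      leftOfParent : ∀ s → layer p ≡ s → pos y < pos p → layer y ≤ suc s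
      leftOfParent zero    eq-p py<pp =
        ⊥-elim (nothing-left-of-root (subst (λ r → pos y < pos r) (layer≡0 p eq-p) py<pp))
      leftOfParent (suc s) eq-p py<pp = ≤-trans
        (layer-monotoneᴮ s y (parent p) (parent-layer p eq-p) ¬Ay (B-parent p eq-p Ap)
          (<-trans py<pp (proj₁ (A-northWest Ap (parent-adjacent p eq-p)))))
        (m≤n+m s 2)
      comparePos : Tri (pos p < pos y) (pos p ≡ pos y) (pos y < pos p) → layer y ≤ suc t
      comparePos (tri< pp<py _ _) = subst (λ s → layer y ≤ suc s) (parent-layer y' eq) (layer-edge (∼-sym G (↘⇒∼
        (pp<py , <-trans (sameColour-val (bothDiffer ¬Ay ¬Ay') py<py') (proj₂ p↘y')))))
      comparePos (tri≈ _ pp≡py _) = ⊥-elim (¬Ay (subst A (pos-injective pp≡py) Ap))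
      comparePos (tri> _ _ py<pp) = leftOfParent t (parent-layer y' eq) py<pp

    A-left-of-next : ∀ x y → A x → ¬ A y → layer y ≡ suc (layer x) → pos x < pos y
    A-left-of-next x y Ax ¬Ay eq with <-cmp (pos x) (pos y)
    ... | tri< px<py _ _ = px<py
    ... | tri≈ _ px≡py _ = ⊥-elim (¬Ay (subst A (pos-injective px≡py) Ax))
    ... | tri> _ _ py<px = ⊥-elim (rightOf (layer x) refl py<px)
      where
      -- otherwise y would be left of the parent p of x, so layer y ≤ layer p.
      rightOf : ∀ s → layer x ≡ s → ¬ pos y < pos x
      rightOf zero    eq-x py<px = nothing-left-of-root (subst (λ r → pos y < pos r) (layer≡0 x eq-x) py<px)
      rightOf (suc s) eq-x py<px = 2+n≰n (trans eq (cong suc eq-x))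
        (≤-trans (layer-monotoneᴮ (layer (parent x)) y (parent x) refl ¬Ay (B-parent x eq-x Ax)
                    (<-trans py<px (proj₁ (A-northWest Ax (parent-adjacent x eq-x)))))
                 (≤-reflexive (parent-layer x eq-x)))

    A-above-previous : ∀ x y → A x → ¬ A y → layer x ≡ suc (layer y) → val y < val x
    A-above-previous x y Ax ¬Ay eq with <-cmp (val y) (val x)
    ... | tri< vy<vx _ _ = vy<vx
    ... | tri≈ _ vy≡vx _ = ⊥-elim (¬Ay (subst A (sym (val-injective vy≡vx)) Ax))
    ... | tri> _ _ vx<vy = ⊥-elim (below (layer y) refl vx<vy)
      where
      -- otherwise x would be left of the parent q of y, so layer x ≤ layer q.
      below : ∀ s → layer y ≡ s → ¬ val x < val y
      below zero    eq-y vx<vy = ¬Ay (cong colour (layer≡0 y eq-y))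
      below (suc s) eq-y vx<vy = 2+n≰n (trans eq (cong suc eq-y))
        (≤-trans (layer-monotoneᴬ (layer q) x q refl Ax Aq
                    (sameColour-pos (trans Ax (sym Aq)) (<-trans vx<vy (proj₂ (A-northWest Aq (∼-sym G (parent-adjacent y eq-y)))))))
                 (≤-reflexive (parent-layer y eq-y)))
        where
        q : Fin n
        q = parent y
        Aq : A q
        Aq = A-parent y eq-y ¬Ay

    upper-rightClosed : ∀ u u' v → layer u ≡ layer u' → layer v ≡ suc (layer u) →
                        u' ∼ v → pos u' < pos u → u ∼ v
    upper-rightClosed u u' v same-layer v-layer u'∼v pu'<pu with A? u'
    ... | yes Au' = ↘⇒∼ (A-left-of-next u v Au (A-neighbour u'∼v Au') v-layer , vv<vu)
      where
      Au : A u
      Au = trans (sameLayer⇒sameColour u u' same-layer) Au'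
      vv<vu : val v < val u
      vv<vu = <-trans (proj₂ (A-northWest Au' u'∼v))
                      (sameColour-val (sameLayer⇒sameColour u' u (sym same-layer)) pu'<pu)
    ... | no ¬Au' = ∼-sym G (↘⇒∼ (<-trans (proj₁ (B-northWest ¬Au' (∼-sym G u'∼v))) pu'<pu ,
                                  A-above-previous v u (B-neighbour u'∼v ¬Au') ¬Au v-layer))
      where
      ¬Au : ¬ A u
      ¬Au Au = ¬Au' (trans (sameLayer⇒sameColour u' u (sym same-layer)) Au)

    lower-leftClosed : ∀ v v' p → layer v' ≡ layer v → layer v ≡ suc (layer p) →
                       v ∼ p → pos v' < pos v → v' ∼ p
    lower-leftClosed v v' p same-layer v-layer v∼p pv'<pv with A? v
    ... | yes Av = ↘⇒∼ (<-trans pv'<pv (proj₁ (A-northWest Av v∼p)) ,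
                        A-above-previous v' p Av' (A-neighbour v∼p Av) (trans same-layer v-layer))
      where
      Av' : A v'
      Av' = trans (sameLayer⇒sameColour v' v same-layer) Av
    ... | no ¬Av = ∼-sym G (↘⇒∼ (A-left-of-next p v' Ap ¬Av' (trans same-layer v-layer) ,
                                  <-trans (sameColour-val (sameLayer⇒sameColour v' v same-layer) pv'<pv)
                                          (proj₂ (B-northWest ¬Av (∼-sym G v∼p)))))
      where
      Ap : A p
      Ap = B-neighbour v∼p ¬Av
      ¬Av' : ¬ A v'
      ¬Av' Av' = ¬Av (trans (sameLayer⇒sameColour v v' (sym same-layer)) Av')

    parent-monotone : ∀ v v' {t} → layer v ≡ suc t → layer v' ≡ layer v → pos v' < pos v →
                      pos (parent v') ≤ pos (parent v)
    parent-monotone v v' eq same-layer pv'<pv =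
      parent-minimal v' (trans same-layer eq)
        (lower-leftClosed v v' (parent v) same-layer (trans eq (cong suc (sym (parent-layer v eq))))
                          (parent-adjacent v eq) pv'<pv)
        (parent-layer v eq)

    keyAt : ℕ → Fin n → List ℕ
    keyAt zero    v = [] ∷ʳ pos v
    keyAt (suc t) v = keyAt t (parent v) ∷ʳ pos v

    key : Fin n → List ℕ
    key v = keyAt (layer v) v

    length-keyAt : ∀ t v → length (keyAt t v) ≡ suc t
    length-keyAt zero    v = refl
    length-keyAt (suc t) v = trans (length-∷ʳ (keyAt t (parent v)) (pos v)) (cong suc (length-keyAt t (parent v)))

    sameLayer⇒sameLength : ∀ u v → layer u ≡ layer v → length (key u) ≡ length (key v)
    sameLayer⇒sameLength u v eq =
      trans (length-keyAt (layer u) u) (trans (cong suc eq) (sym (length-keyAt (layer v) v)))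

    key-parent : ∀ v {t} → layer v ≡ suc t → key v ≡ key (parent v) ∷ʳ pos v
    key-parent v {t} eq = trans (cong (λ s → keyAt s v) eq)
                                (cong (λ s → keyAt s (parent v) ∷ʳ pos v) (sym (parent-layer v eq)))

    -- Every key ends with the position of its vertex, so keys are distinct.
    keyAt-last : ∀ t v → ∃[ xs ] keyAt t v ≡ xs ∷ʳ pos v
    keyAt-last zero    v = [] , refl
    keyAt-last (suc t) v = keyAt t (parent v) , refl

    key-injective : ∀ {u v} → key u ≡ key v → u ≡ v
    key-injective {u} {v} eq with keyAt-last (layer u) u | keyAt-last (layer v) v
    ... | xs , key-u | ys , key-v = pos-injective (∷ʳ-injectiveʳ xs ys (trans (sym key-u) (trans eq key-v)))

    infix 4 _≺_
    _≺_ : Fin n → Fin n → Set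
    u ≺ v = key u ⊏ key v

    open IsStrictTotalOrder ⊏-isStrictTotalOrder using (compare) renaming (trans to ⊏-trans; asym to ⊏-asym)

    ≺-trans : Transitive _≺_
    ≺-trans = ⊏-trans

    ≺-compare : Trichotomous _≡_ _≺_
    ≺-compare u v with compare (key u) (key v)
    ... | tri< u≺v u≉v v⊀u = tri< u≺v (λ u≡v → u≉v (≡⇒Pointwise-≡ (cong key u≡v))) v⊀u
    ... | tri≈ u⊀v u≈v v⊀u = tri≈ u⊀v (key-injective (Pointwise-≡⇒≡ u≈v)) v⊀u
    ... | tri> u⊀v u≉v v≺u = tri> u⊀v (λ u≡v → u≉v (≡⇒Pointwise-≡ (cong key u≡v))) v≺u

    sameLayer-order : ∀ m u v → layer u ≡ m → layer v ≡ m → pos v < pos u → u ≺ v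
    sameLayer-order zero    u v u-layer v-layer pv<pu =
      ⊥-elim (<-irrefl (cong pos (trans (layer≡0 v v-layer) (sym (layer≡0 u u-layer)))) pv<pu)
    sameLayer-order (suc t) u v u-layer v-layer pv<pu =
      subst₂ _⊏_ (sym (key-parent u u-layer)) (sym (key-parent v v-layer))
             (compareParents (<-cmp (pos (parent v)) (pos (parent u))))
      where
      compareParents : Tri (pos (parent v) < pos (parent u)) (pos (parent v) ≡ pos (parent u))
                           (pos (parent u) < pos (parent v)) →
                       key (parent u) ∷ʳ pos u ⊏ key (parent v) ∷ʳ pos v
      compareParents (tri< ppv<ppu _ _) =
        ∷ʳ-mono (pos u) (pos v)
          (sameLayer⇒sameLength (parent u) (parent v) (trans (parent-layer u u-layer) (sym (parent-layer v v-layer))))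
          (sameLayer-order t (parent u) (parent v) (parent-layer u u-layer) (parent-layer v v-layer) ppv<ppu)
      compareParents (tri≈ _ ppv≡ppu _) =
        subst (λ w → key (parent u) ∷ʳ pos u ⊏ key w ∷ʳ pos v) (pos-injective (sym ppv≡ppu))
              (∷ʳ-last (key (parent u)) pv<pu)
      compareParents (tri> _ _ ppu<ppv) =
        ⊥-elim (<⇒≱ ppu<ppv (parent-monotone u v u-layer (trans v-layer (sym u-layer)) pv<pu))

    -- Between consecutive layers the order detects adjacency: u is adjacent to
    -- v iff it comes no later than the parent of v, that is, iff u ≺ v.
    module _ (u v : Fin n) (v-layer : layer v ≡ suc (layer u)) where
      private
        p : Fin n
        p = parent v
        p-layer : layer p ≡ layer u
        p-layer = parent-layer v v-layer
        p∼v : p ∼ v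
        p∼v = ∼-sym G (parent-adjacent v v-layer)
        key-v : key v ≡ key p ∷ʳ pos v
        key-v = key-parent v v-layer
        same-length : length (key u) ≡ length (key p)
        same-length = sameLayer⇒sameLength u p (sym p-layer)

      ≺⇒adjacent : u ≺ v → u ∼ v
      ≺⇒adjacent u≺v with ⊏-∷ʳ-inv (pos v) same-length (subst (key u ⊏_) key-v u≺v)
      ... | inj₂ key-u≡key-p = subst (_∼ v) (sym (key-injective key-u≡key-p)) p∼v
      ... | inj₁ u≺p with <-cmp (pos p) (pos u)
      ...   | tri< pp<pu _ _ = upper-rightClosed u p v (sym p-layer) v-layer p∼v pp<pu
      ...   | tri≈ _ pp≡pu _ = subst (_∼ v) (pos-injective pp≡pu) p∼v
      ...   | tri> _ _ pu<pp = ⊥-elim (⊏-asym u≺p (sameLayer-order (layer u) p u p-layer refl pu<pp))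

      adjacent⇒≺ : u ∼ v → u ≺ v
      adjacent⇒≺ u∼v = subst (key u ⊏_) (sym key-v)
        (fromParent (m≤n⇒m<n∨m≡n (parent-minimal v v-layer (∼-sym G u∼v) refl)))
        where
        fromParent : pos p < pos u ⊎ pos p ≡ pos u → key u ⊏ key p ∷ʳ pos v
        fromParent (inj₁ pp<pu) = ⊏-extend (pos v) same-length (sameLayer-order (layer u) u p refl p-layer pp<pu)
        fromParent (inj₂ pp≡pu) = subst (λ w → key u ⊏ key w ∷ʳ pos v) (pos-injective (sym pp≡pu)) (⊏-∷ʳ (key u) (pos v))

    ≺⇒[adjacent⇔nextLayer] : ∀ {u v} → u ≺ v → u ∼ v ⇔ suc (layer u) ≡ layer v
    ≺⇒[adjacent⇔nextLayer] {u} {v} u≺v = mk⇔ nextLayer (λ eq → ≺⇒adjacent u v (sym eq) u≺v)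
      where
      nextLayer : u ∼ v → suc (layer u) ≡ layer v
      nextLayer u∼v with consecutive u∼v
      ... | inj₁ eq = eq
      ... | inj₂ eq = ⊥-elim (⊏-asym u≺v (adjacent⇒≺ v u (sym eq) (∼-sym G u∼v)))

mainTheorem13 : (k : ℕ) → (n : ℕ) → (G : Graph n)
    → IsConnected G → IsBipartite G → IsPermutationGraph G
    → ¬ ContainsInducedPath (suc k) G
    → IsKLetterGraph (suc k) G
mainTheorem13 k zero G _ _ _ _ =
  ordered⇒letterGraph G {_≺_ = λ _ _ → ⊥} (λ ()) (λ ()) (λ _ _ → false) (λ ()) (λ ())
mainTheorem13 k (suc m) G connected (colour , proper) permutation noPath =
  ordered⇒letterGraph G {_≺_ = _≺_} (λ {u} {v} {w} → ≺-trans {u} {v} {w}) ≺-compare nextLetter letter adjacency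
  where
  open BipartitePlane G (planeModel G permutation) colour (λ {u} {v} → proper u v)
  open Rooted (proj₁ (minimum pos)) (proj₂ (minimum pos)) (λ v → connected v _)

  letter : Fin (suc m) → Fin (suc k)
  letter v = fromℕ< (layer-bound noPath v)

  nextLetter : Fin (suc k) → Fin (suc k) → Bool
  nextLetter a b = does (suc (toℕ a) ≟ toℕ b)

  adjacency : ∀ u v → u ≺ v → adj G u v ≡ nextLetter (letter u) (letter v)
  adjacency u v u≺v = does-⇔ letters-agree (T? (adj G u v)) (suc (toℕ (letter u)) ≟ toℕ (letter v))
    where
    letters-agree : u ∼ v ⇔ suc (toℕ (letter u)) ≡ toℕ (letter v)
    letters-agree = subst₂ (λ a b → u ∼ v ⇔ suc a ≡ b) (sym (toℕ-fromℕ< _)) (sym (toℕ-fromℕ< _)) (≺⇒[adjacent⇔nextLayer] u≺v)
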